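{- For each $q\in\{25,49,121\}$ there exists an $(\mathbb{F}_4\times\mathbb{F}_q,\ \mathbb{F}_4\times\{0\},\ 4,1)$-BRDF and a nested $(4q,4,1)$-BIBD.
   Context: Here $\mathbb{F}_4\times\mathbb{F}_q$ denotes the additive group of the direct product of the finite fields of orders $4$ and $q$. For a finite additive group $G$ and subgroup $H$, a $(G,H,k,\lambda)$-RDF is a set $\mathcal{F}$ of $k$-subsets of $G$ (base blocks) such that the multiset of differences $x-y$, over ordered pairs of distinct elements $x,y$ in a common base block, contains each element of $G\setminus H$ exactly $\lambda$ times and no element of $H$; a $(G,H,k,\lambda)$-BRDF is such an RDF with every base block disjoint from $H$ and the sets $B$, $-B=\{ -b:b\in B\}$ ($B\in\mathcal{F}$) pairwise disjoint (including $B\cap-B=\emptyset$). A $(v,k,\lambda)$-BIBD is a pair $(X,\mathcal{A})$ with $|X|=v$ and $\mathcal{A}$ a collection of $k$-subsets (blocks) such that every pair of distinct points lies in exactly $\lambda$ blocks; a partial one has "at most $\lambda$". A nested $(v,k,\lambda)$-BIBD is a $(v,k,\lambda)$-BIBD $(X,\mathcal{A})$ together with a map $\phi:\mathcal{A}\to X$ such that $(X,\{A\cup\{\phi(A)\}:A\in\mathcal{A}\})$ is a partial $(v,k+1,\lambda+1)$-BIBD (augmented blocks of size $k+1$). -}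

module Defs where

open import Data.Nat using (ℕ; zero; suc; _+_; _*_; _∸_)
open import Data.Nat.DivMod using (_mod_)
open import Data.Fin using (Fin; toℕ)
import Data.Fin.Properties as FinP
open import Data.Product using (Σ; _×_; _,_; proj₁; proj₂)
import Data.Product.Properties as ProdP
open import Data.List using (List; []; _∷_; length; filter; map; concat; concatMap; _++_; all)
open import Data.List.Relation.Unary.Unique.Propositional using (Unique)
import Data.List.Membership.DecPropositional as DecMem
open import Data.List.Membership.Propositional using (_∈_)
open import Relation.Binary.Definitions using (DecidableEquality)
open import Relation.Binary.PropositionalEquality using (_≡_)
open import Relation.Nullary using (¬_; Dec; yes; no)
open import Relation.Nullary.Decidable using (_×-dec_; ¬?)
open import Data.Nat using (_≤_)

_⊕_ : ∀ {n} → Fin n → Fin n → Fin n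
_⊕_ {suc m} a b = (toℕ a + toℕ b) mod (suc m)

⊝_ : ∀ {n} → Fin n → Fin n
⊝_ {suc m} a = (suc m ∸ toℕ a) mod (suc m)

-- The additive group of F_4 × F_q, q = p², p prime.
-- Additive group of F_4 is Z_2 × Z_2; of F_{p²} is Z_p × Z_p.
-- An element is (a₁ , a₂ , b₁ , b₂) with a's in Z_2 and b's in Z_p.

G : ℕ → Set
G p = Fin 2 × Fin 2 × Fin p × Fin p

gadd : ∀ {p} → G p → G p → G p
gadd (a₁ , a₂ , b₁ , b₂) (c₁ , c₂ , d₁ , d₂) =
  (a₁ ⊕ c₁ , a₂ ⊕ c₂ , b₁ ⊕ d₁ , b₂ ⊕ d₂)

gneg : ∀ {p} → G p → G p
gneg (a₁ , a₂ , b₁ , b₂) = (⊝ a₁ , ⊝ a₂ , ⊝ b₁ , ⊝ b₂)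

gsub : ∀ {p} → G p → G p → G p
gsub x y = gadd x (gneg y)

_≟G_ : ∀ {p} → DecidableEquality (G p)
_≟G_ = ProdP.≡-dec FinP._≟_ (ProdP.≡-dec FinP._≟_ (ProdP.≡-dec FinP._≟_ FinP._≟_))

InH : ∀ {p} → G p → Set
InH {p} (a₁ , a₂ , b₁ , b₂) = (toℕ b₁ ≡ 0) × (toℕ b₂ ≡ 0)

module _ {X : Set} (_≟_ : DecidableEquality X) where
  open DecMem _≟_ using (_∈?_)

  IsKSubset : ℕ → List X → Set
  IsKSubset k B = (length B ≡ k) × Unique B

  count : X → List X → ℕ
  count x xs = length (filter (x ≟_) xs)

  diffsOf : (X → X → X) → List X → List X
  diffsOf sub B =
    concatMap (λ x → map (λ y → sub x y) (filter (λ y → ¬? (x ≟ y)) B)) B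

  pairCount : List (List X) → X → X → ℕ
  pairCount 𝒜 x y = length (filter (λ A → (x ∈? A) ×-dec (y ∈? A)) 𝒜)

  -- (v,k,λ)-BIBD on point set X (all of whose elements are listed, |X| = v
  -- is enforced by taking X = Fin v below)
  IsBIBD : ℕ → ℕ → List (List X) → Set
  IsBIBD k lam 𝒜 =
    ((A : List X) → A ∈ 𝒜 → IsKSubset k A) ×
    ((x y : X) → ¬ (x ≡ y) → pairCount 𝒜 x y ≡ lam)

  IsPartialBIBD : ℕ → ℕ → List (List X) → Set
  IsPartialBIBD k lam 𝒜 =
    ((A : List X) → A ∈ 𝒜 → IsKSubset k A) ×
    ((x y : X) → ¬ (x ≡ y) → pairCount 𝒜 x y ≤ lam)

  -- nested (v,k,λ)-BIBD: the collection of blocks is given as a list of pairs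
  -- (A , φ(A)); the underlying blocks form a (v,k,λ)-BIBD and the augmented
  -- blocks A ∪ {φ(A)} (of size k+1) form a partial (v,k+1,λ+1)-BIBD.
  IsNestedBIBD : ℕ → ℕ → List (List X × X) → Set
  IsNestedBIBD k lam 𝒩 =
    IsBIBD k lam (map proj₁ 𝒩) ×
    IsPartialBIBD (suc k) (suc lam) (map (λ Aφ → proj₂ Aφ ∷ proj₁ Aφ) 𝒩)

IsRDF : (p k lam : ℕ) → List (List (G p)) → Set
IsRDF p k lam ℱ =
  ((B : List (G p)) → B ∈ ℱ → IsKSubset _≟G_ k B) ×
  ((g : G p) → (¬ InH g → count _≟G_ g D ≡ lam) × (InH g → count _≟G_ g D ≡ 0))
  where
    D = concatMap (diffsOf _≟G_ gsub) ℱ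

-- BRDF: an RDF whose base blocks avoid H and such that the sets B, -B
-- (B ∈ ℱ) are pairwise disjoint (including B ∩ -B = ∅); for duplicate-free
-- blocks this is exactly: the concatenation of all B and -B has no repetition.
IsBRDF : (p k lam : ℕ) → List (List (G p)) → Set
IsBRDF p k lam ℱ =
  IsRDF p k lam ℱ ×
  ((B : List (G p)) → B ∈ ℱ → (b : G p) → b ∈ B → ¬ InH b) ×
  Unique (concatMap (λ B → B ++ map gneg B) ℱ)

-- Write H = F₄ × {0} as the kernel of the projection π of G = F₄ × F_q onto F_q. The nested
-- design consists of the translates B + g of the base blocks, nested with g, and of the cosets
-- H + c, nested with t + c. Since ℱ is a relative difference family, a pair x ≠ y with x − y ∉ H
-- lies in exactly one translate, and a pair with x − y ∈ H in exactly one coset. Augmenting B + g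
-- by g gives the translate of {0} ∪ B, which adds the differences ±B; augmenting the cosets adds
-- differences in t + H and −t + H. The BRDF property and the choice of t make B, −B, t + H and
-- −t + H pairwise disjoint, so every difference occurs at most twice among the augmented blocks.
-- For q = 25, 49, 121 the base blocks and t are explicit and all conditions on them are checked
-- by evaluation.

module Submission where

open import Defs
open import Level using (0ℓ)
open import Algebra.Core using (Op₁; Op₂)
open import Algebra.Bundles using (AbelianGroup; Group)
open import Algebra.Structures using (IsAbelianGroup; IsGroup)
import Algebra.Properties.AbelianGroup
import Algebra.Properties.CommutativeSemigroup
import Algebra.Properties.Group
open import Data.Empty using (⊥-elim)
open import Data.Nat using (ℕ; zero; suc; _+_; _*_; _∸_; _%_; _≤_; z≤n; s≤s; NonZero)
import Data.Nat as ℕ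
open import Data.Nat.Properties
  using (+-assoc; +-comm; +-identityʳ; *-identityˡ; *-distribʳ-+; *-mono-≤; +-mono-≤; +-monoʳ-≤;
         ≤-reflexive; ≤-trans; m∸n+n≡m; ≤-decTotalOrder; +-commutativeSemigroup; module ≤-Reasoning)
open import Data.Nat.DivMod using (_mod_; %-distribˡ-+; m%n%n≡m%n; m<n⇒m%n≡m; n%n≡0)
open import Data.Nat.Tactic.RingSolver using (solve-∀)
open import Data.Fin using (Fin; toℕ)
open import Data.Fin.Properties using (_≟_; *↔×; toℕ-fromℕ<; toℕ-injective; toℕ<n; toℕ≤n)
open import Data.List using (List; []; _∷_; map; concatMap; filter; length; _++_; allFin; cartesianProduct)
open import Data.List.Properties using (length-map; length-++; filter-++; map-∘; map-cong; map-id)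
open import Data.List.Membership.Propositional using (_∈_; _∉_)
open import Data.List.Membership.Propositional.Properties
  using (∈-map⁺; ∈-map⁻; ∈-filter⁺; ∈-filter⁻; ∈-allFin; ∈-cartesianProduct⁺)
import Data.List.Membership.DecPropositional as DecMembership
open import Data.List.Relation.Unary.Any as Any using (here; there)
open import Data.List.Relation.Unary.All as All using (All; []; _∷_)
import Data.List.Relation.Unary.All.Properties as AllP
open import Data.List.Relation.Unary.AllPairs using ([]; _∷_)
open import Data.List.Relation.Unary.Unique.Propositional using (Unique)
import Data.List.Relation.Unary.Unique.Propositional.Properties as Unique
open import Data.List.Relation.Unary.Unique.DecPropositional using (unique?)
open import Data.List.Relation.Binary.Permutation.Propositional using (_↭_; ↭-sym; ↭-trans)
open import Data.List.Relation.Binary.Permutation.Propositional.Properties using (↭-length; filter-↭)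
open import Data.List.Sort.MergeSort.Base ≤-decTotalOrder using (sort)
open import Data.List.Sort.MergeSort.Properties ≤-decTotalOrder using (sort-↭)
open import Data.Product using (Σ; _×_; _,_; proj₁; proj₂)
import Data.Product as Product
open import Data.Product.Properties using () renaming (≡-dec to ×-≡-dec)
open import Data.Product.Function.NonDependent.Propositional using (_×-↔_)
open import Data.Sum using (_⊎_; inj₁; inj₂)
open import Function using (_∘_)
open import Function.Bundles using (_↔_; Inverse; Injection)
open import Function.Properties.Inverse using (↔-sym; ↔-trans; ↔⇒↣)
open import Function.Related.TypeIsomorphisms using (Σ-assoc)
open import Relation.Nullary using (Dec; yes; no; ¬_)
open import Relation.Nullary.Decidable using (True; toWitness; ¬?; _×-dec_)
open import Data.Unit using (tt)
open import Relation.Unary using (Decidable)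
open import Relation.Binary.Definitions using (DecidableEquality)
open import Relation.Binary.PropositionalEquality

-- Counting with indicator sums

private variable
  A B P Q : Set

∑ : List A → (A → ℕ) → ℕ
∑ []       f = 0
∑ (x ∷ xs) f = f x + ∑ xs f

infixr 8 ∑
syntax ∑ xs (λ x → e) = ∑[ x ∈ xs ] e

𝟙 : Dec P → ℕ
𝟙 (yes _) = 1
𝟙 (no _)  = 0

𝟙-yes : (P? : Dec P) → P → 𝟙 P? ≡ 1
𝟙-yes (yes _) _  = refl
𝟙-yes (no ¬p) p = ⊥-elim (¬p p)

𝟙-no : (P? : Dec P) → ¬ P → 𝟙 P? ≡ 0
𝟙-no (yes p) ¬p = ⊥-elim (¬p p)
𝟙-no (no _)  _  = refl

𝟙-mono : (P → Q) → (P? : Dec P) (Q? : Dec Q) → 𝟙 P? ≤ 𝟙 Q?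
𝟙-mono P⇒Q (yes p) Q? = ≤-reflexive (sym (𝟙-yes Q? (P⇒Q p)))
𝟙-mono P⇒Q (no _)  Q? = z≤n

𝟙-cong : (P → Q) → (Q → P) → (P? : Dec P) (Q? : Dec Q) → 𝟙 P? ≡ 𝟙 Q?
𝟙-cong P⇒Q Q⇒P (yes p) Q? = sym (𝟙-yes Q? (P⇒Q p))
𝟙-cong P⇒Q Q⇒P (no ¬p) Q? = sym (𝟙-no Q? (λ q → ¬p (Q⇒P q)))

𝟙-× : (P? : Dec P) (Q? : Dec Q) → 𝟙 (P? ×-dec Q?) ≡ 𝟙 P? * 𝟙 Q?
𝟙-× (yes _) (yes _) = refl
𝟙-× (yes _) (no _)  = refl
𝟙-× (no _)  _       = refl

𝟙-¬ : (P? : Dec P) → 𝟙 (¬? P?) + 𝟙 P? ≡ 1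
𝟙-¬ (yes _) = refl
𝟙-¬ (no _)  = refl

length-filter : {P : A → Set} (P? : Decidable P) (xs : List A) →
                length (filter P? xs) ≡ ∑[ x ∈ xs ] 𝟙 (P? x)
length-filter P? []       = refl
length-filter P? (x ∷ xs) with P? x
... | yes _ = cong suc (length-filter P? xs)
... | no _  = length-filter P? xs

∑-filter : {P : A → Set} (P? : Decidable P) (xs : List A) (f : A → ℕ) →
           ∑ (filter P? xs) f ≡ ∑[ x ∈ xs ] (𝟙 (P? x) * f x)
∑-filter P? []       f = refl
∑-filter P? (x ∷ xs) f with P? x
... | yes _ = cong₂ _+_ (sym (+-identityʳ (f x))) (∑-filter P? xs f)
... | no _  = ∑-filter P? xs f

∑-++ : (xs ys : List A) (f : A → ℕ) → ∑ (xs ++ ys) f ≡ ∑ xs f + ∑ ys f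
∑-++ []       ys f = refl
∑-++ (x ∷ xs) ys f = trans (cong (f x +_) (∑-++ xs ys f)) (sym (+-assoc (f x) _ _))

∑-concatMap : (g : A → List B) (xs : List A) (f : B → ℕ) →
              ∑ (concatMap g xs) f ≡ ∑[ x ∈ xs ] ∑ (g x) f
∑-concatMap g []       f = refl
∑-concatMap g (x ∷ xs) f =
  trans (∑-++ (g x) (concatMap g xs) f) (cong (∑ (g x) f +_) (∑-concatMap g xs f))

∑-map : (h : A → B) (xs : List A) (f : B → ℕ) → ∑ (map h xs) f ≡ ∑[ x ∈ xs ] f (h x)
∑-map h []       f = refl
∑-map h (x ∷ xs) f = cong (f (h x) +_) (∑-map h xs f)

∑-cong-∈ : (xs : List A) {f g : A → ℕ} → (∀ {x} → x ∈ xs → f x ≡ g x) → ∑ xs f ≡ ∑ xs g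
∑-cong-∈ []       f≡g = refl
∑-cong-∈ (x ∷ xs) f≡g = cong₂ _+_ (f≡g (here refl)) (∑-cong-∈ xs (λ x∈ → f≡g (there x∈)))

∑-cong : (xs : List A) {f g : A → ℕ} → (∀ x → f x ≡ g x) → ∑ xs f ≡ ∑ xs g
∑-cong xs f≡g = ∑-cong-∈ xs (λ {x} _ → f≡g x)

∑-mono : (xs : List A) {f g : A → ℕ} → (∀ x → f x ≤ g x) → ∑ xs f ≤ ∑ xs g
∑-mono []       f≤g = z≤n
∑-mono (x ∷ xs) f≤g = +-mono-≤ (f≤g x) (∑-mono xs f≤g)

∑-zero : (xs : List A) → ∑[ x ∈ xs ] 0 ≡ 0
∑-zero []       = refl
∑-zero (x ∷ xs) = ∑-zero xs

∑-+ : (xs : List A) (f g : A → ℕ) → ∑[ x ∈ xs ] (f x + g x) ≡ ∑ xs f + ∑ xs g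
∑-+ []       f g = refl
∑-+ (x ∷ xs) f g = trans (cong (f x + g x +_) (∑-+ xs f g)) (interchange (f x) (g x) _ _)
  where open Algebra.Properties.CommutativeSemigroup +-commutativeSemigroup using (interchange)

∑-*ʳ : (xs : List A) (f : A → ℕ) (c : ℕ) → ∑[ x ∈ xs ] (f x * c) ≡ ∑ xs f * c
∑-*ʳ []       f c = refl
∑-*ʳ (x ∷ xs) f c = trans (cong (f x * c +_) (∑-*ʳ xs f c)) (sym (*-distribʳ-+ c (f x) (∑ xs f)))

∑-swap : (xs : List A) (ys : List B) (f : A → B → ℕ) →
         ∑[ x ∈ xs ] ∑[ y ∈ ys ] f x y ≡ ∑[ y ∈ ys ] ∑[ x ∈ xs ] f x y
∑-swap []       ys f = sym (∑-zero ys)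
∑-swap (x ∷ xs) ys f =
  trans (cong (∑ ys (f x) +_) (∑-swap xs ys f)) (sym (∑-+ ys (f x) (λ y → ∑[ x ∈ xs ] f x y)))

Enumerates : List A → Set
Enumerates xs = Unique xs × (∀ x → x ∈ xs)

allFin-enumerates : ∀ n → Enumerates (allFin n)
allFin-enumerates n = Unique.allFin⁺ n , ∈-allFin

cartesianProduct-enumerates : {xs : List A} {ys : List B} →
  Enumerates xs → Enumerates ys → Enumerates (cartesianProduct xs ys)
cartesianProduct-enumerates (xs-uniq , xs-complete) (ys-uniq , ys-complete) =
  Unique.cartesianProduct⁺ xs-uniq ys-uniq ,
  λ (x , y) → ∈-cartesianProduct⁺ (xs-complete x) (ys-complete y)

module Occurrences {X : Set} (_≟_ : DecidableEquality X) where
  open DecMembership _≟_ using (_∈?_)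

  count≡∑ : ∀ x xs → count _≟_ x xs ≡ ∑[ y ∈ xs ] 𝟙 (x ≟ y)
  count≡∑ x = length-filter (x ≟_)

  count-++ : ∀ x xs ys → count _≟_ x (xs ++ ys) ≡ count _≟_ x xs + count _≟_ x ys
  count-++ x xs ys = trans (cong length (filter-++ (x ≟_) xs ys)) (length-++ (filter (x ≟_) xs))

  count-↭ : ∀ x {xs ys} → xs ↭ ys → count _≟_ x xs ≡ count _≟_ x ys
  count-↭ x xs↭ys = ↭-length (filter-↭ (x ≟_) xs↭ys)

  count-concatMap : ∀ x (f : A → List X) xs →
                    count _≟_ x (concatMap f xs) ≡ ∑[ a ∈ xs ] count _≟_ x (f a)
  count-concatMap x f xs = begin
    count _≟_ x (concatMap f xs)           ≡⟨ count≡∑ x (concatMap f xs) ⟩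
    ∑[ y ∈ concatMap f xs ] 𝟙 (x ≟ y)      ≡⟨ ∑-concatMap f xs _ ⟩
    ∑[ a ∈ xs ] ∑[ y ∈ f a ] 𝟙 (x ≟ y)     ≡⟨ ∑-cong xs (λ a → sym (count≡∑ x (f a))) ⟩
    ∑[ a ∈ xs ] count _≟_ x (f a)          ∎
    where open ≡-Reasoning

  count-∉ : ∀ {x xs} → x ∉ xs → count _≟_ x xs ≡ 0
  count-∉ {x} {[]}     x∉ = refl
  count-∉ {x} {y ∷ xs} x∉ with x ≟ y
  ... | yes x≡y = ⊥-elim (x∉ (here x≡y))
  ... | no _    = count-∉ (λ x∈ → x∉ (there x∈))

  count-unique : ∀ x {xs} → Unique xs → count _≟_ x xs ≡ 𝟙 (x ∈? xs)
  count-unique x {[]}     []          = refl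
  count-unique x {y ∷ xs} (y∉ ∷ uniq) with x ≟ y
  ... | yes refl = cong suc (count-∉ (λ x∈ → All.lookup y∉ x∈ refl))
  ... | no x≢y   = trans (count-unique x uniq)
                         (𝟙-cong there (Any.tail x≢y) (x ∈? xs) _)

  unique⇒count≤1 : ∀ x {xs} → Unique xs → count _≟_ x xs ≤ 1
  unique⇒count≤1 x {xs} uniq = subst (_≤ 1) (sym (count-unique x uniq)) (𝟙≤1 (x ∈? xs))
    where
    𝟙≤1 : (P? : Dec P) → 𝟙 P? ≤ 1
    𝟙≤1 (yes _) = s≤s z≤n
    𝟙≤1 (no _)  = z≤n

  count-map : ∀ x (h : A → X) xs → count _≟_ x (map h xs) ≡ ∑[ a ∈ xs ] 𝟙 (x ≟ h a)
  count-map x h xs = trans (count≡∑ x (map h xs)) (∑-map h xs _)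

  count-enumeration : ∀ {xs} → Enumerates xs → ∀ x → count _≟_ x xs ≡ 1
  count-enumeration {xs} (uniq , complete) x =
    trans (count-unique x uniq) (𝟙-yes (x ∈? xs) (complete x))

  ∑-enumeration-pick : ∀ {xs} → Enumerates xs → ∀ x (w : X → ℕ) →
                       ∑[ y ∈ xs ] (𝟙 (x ≟ y) * w y) ≡ w x
  ∑-enumeration-pick {xs} enum x w = begin
    ∑[ y ∈ xs ] (𝟙 (x ≟ y) * w y)    ≡⟨ ∑-cong xs only-x ⟩
    ∑[ y ∈ xs ] (𝟙 (x ≟ y) * w x)    ≡⟨ ∑-*ʳ xs _ (w x) ⟩
    ∑[ y ∈ xs ] 𝟙 (x ≟ y) * w x      ≡⟨ cong (_* w x) (sym (count≡∑ x xs)) ⟩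
    count _≟_ x xs * w x             ≡⟨ cong (_* w x) (count-enumeration enum x) ⟩
    1 * w x                          ≡⟨ *-identityˡ (w x) ⟩
    w x                              ∎
    where
    open ≡-Reasoning
    only-x : ∀ y → 𝟙 (x ≟ y) * w y ≡ 𝟙 (x ≟ y) * w x
    only-x y with x ≟ y
    ... | yes refl = refl
    ... | no _     = refl

  ∑-enumeration-pick₂ : ∀ {xs} → Enumerates xs → (u v : X → ℕ) → (∀ x → u x * v x ≡ 0) →
    ∀ a b → ∑[ x ∈ xs ] ((u x + 𝟙 (a ≟ x)) * (v x + 𝟙 (b ≟ x))) ≡ u b + (v a + 𝟙 (b ≟ a))
  ∑-enumeration-pick₂ {xs} enum u v uv≡0 a b = begin
    ∑[ x ∈ xs ] ((u x + δa x) * (v x + δb x))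
      ≡⟨ ∑-cong xs (λ x → expand (u x) (δa x) (v x) (δb x)) ⟩
    ∑[ x ∈ xs ] (u x * v x + (δb x * u x + (δa x * v x + δa x * δb x)))
      ≡⟨ ∑-+ xs _ _ ⟩
    ∑[ x ∈ xs ] (u x * v x) + ∑[ x ∈ xs ] (δb x * u x + (δa x * v x + δa x * δb x))
      ≡⟨ cong₂ _+_ (trans (∑-cong xs uv≡0) (∑-zero xs))
                   (trans (∑-+ xs (λ x → δb x * u x) _)
                          (cong (∑[ x ∈ xs ] (δb x * u x) +_) (∑-+ xs (λ x → δa x * v x) _))) ⟩
    0 + (∑[ x ∈ xs ] (δb x * u x) + (∑[ x ∈ xs ] (δa x * v x) + ∑[ x ∈ xs ] (δa x * δb x)))
      ≡⟨ cong₂ _+_ (pick b u) (cong₂ _+_ (pick a v) (pick a δb)) ⟩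
    u b + (v a + 𝟙 (b ≟ a))
      ∎
    where
    open ≡-Reasoning
    δa δb : X → ℕ
    δa x = 𝟙 (a ≟ x)
    δb x = 𝟙 (b ≟ x)
    pick : ∀ c (w : X → ℕ) → ∑[ x ∈ xs ] (𝟙 (c ≟ x) * w x) ≡ w c
    pick = ∑-enumeration-pick enum
    expand : ∀ p q r s → (p + q) * (r + s) ≡ p * r + (s * p + (q * r + q * s))
    expand = solve-∀

  count-filter : ∀ {xs} → Enumerates xs → {P : X → Set} (P? : Decidable P) →
                 ∀ x → count _≟_ x (filter P? xs) ≡ 𝟙 (P? x)
  count-filter {xs} (uniq , complete) P? x =
    trans (count-unique x (Unique.filter⁺ P? uniq))
          (𝟙-cong (λ x∈ → proj₂ (∈-filter⁻ P? {xs = xs} x∈)) (∈-filter⁺ P? (complete x)) _ (P? x))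

  inBoth : X → X → List X → ℕ
  inBoth x y A = 𝟙 (x ∈? A) * 𝟙 (y ∈? A)

  pairCount≡∑ : ∀ 𝒜 x y → pairCount _≟_ 𝒜 x y ≡ ∑[ A ∈ 𝒜 ] inBoth x y A
  pairCount≡∑ 𝒜 x y =
    trans (length-filter _ 𝒜) (∑-cong 𝒜 (λ A → 𝟙-× (x ∈? A) (y ∈? A)))

  count-diffsOf : ∀ (_-_ : X → X → X) d B →
    count _≟_ d (diffsOf _≟_ _-_ B)
      ≡ ∑[ b ∈ B ] ∑[ c ∈ B ] (𝟙 (¬? (b ≟ c)) * 𝟙 (d ≟ (b - c)))
  count-diffsOf _-_ d B = begin
    count _≟_ d (diffsOf _≟_ _-_ B)
      ≡⟨ count-concatMap d _ B ⟩
    ∑[ b ∈ B ] count _≟_ d (map (b -_) (filter (λ c → ¬? (b ≟ c)) B))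
      ≡⟨ ∑-cong B (λ b → count-map d (b -_) (filter (λ c → ¬? (b ≟ c)) B)) ⟩
    ∑[ b ∈ B ] ∑[ c ∈ filter (λ c → ¬? (b ≟ c)) B ] 𝟙 (d ≟ (b - c))
      ≡⟨ ∑-cong B (λ b → ∑-filter (λ c → ¬? (b ≟ c)) B _) ⟩
    ∑[ b ∈ B ] ∑[ c ∈ B ] (𝟙 (¬? (b ≟ c)) * 𝟙 (d ≟ (b - c)))
      ∎
    where open ≡-Reasoning

  count-diffsOf-∷ : ∀ (_-_ : X → X → X) d {a B} → a ∉ B →
    count _≟_ d (diffsOf _≟_ _-_ (a ∷ B))
      ≡ count _≟_ d (map (a -_) B) + (count _≟_ d (map (_- a) B) + count _≟_ d (diffsOf _≟_ _-_ B))
  count-diffsOf-∷ _-_ d {a} {B} a∉B = begin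
    count _≟_ d (diffsOf _≟_ _-_ (a ∷ B))
      ≡⟨ count-diffsOf _-_ d (a ∷ B) ⟩
    ∑[ c ∈ a ∷ B ] (off a c * δ (a - c))
      + ∑[ b ∈ B ] (off b a * δ (b - a) + ∑[ c ∈ B ] (off b c * δ (b - c)))
      ≡⟨ cong₂ _+_ row-a (trans (∑-+ B _ _) (cong₂ _+_ column-a (sym (count-diffsOf _-_ d B)))) ⟩
    count _≟_ d (map (a -_) B) + (count _≟_ d (map (_- a) B) + count _≟_ d (diffsOf _≟_ _-_ B))
      ∎
    where
    open ≡-Reasoning
    δ : X → ℕ
    δ z = 𝟙 (d ≟ z)
    off : X → X → ℕ
    off b c = 𝟙 (¬? (b ≟ c))
    a≢ : ∀ {c} → c ∈ B → a ≢ c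
    a≢ c∈B refl = a∉B c∈B
    row-a : ∑[ c ∈ a ∷ B ] (off a c * δ (a - c)) ≡ count _≟_ d (map (a -_) B)
    row-a = begin
      off a a * δ (a - a) + ∑[ c ∈ B ] (off a c * δ (a - c))
        ≡⟨ cong₂ _+_ (cong (_* δ (a - a)) (𝟙-no (¬? (a ≟ a)) (λ a≢a → a≢a refl)))
                     (∑-cong-∈ B (λ {c} c∈B → trans (cong (_* δ (a - c)) (𝟙-yes (¬? (a ≟ c)) (a≢ c∈B)))
                                                    (+-identityʳ _))) ⟩
      ∑[ c ∈ B ] δ (a - c)
        ≡⟨ count-map d (a -_) B ⟨
      count _≟_ d (map (a -_) B)
        ∎
    column-a : ∑[ b ∈ B ] (off b a * δ (b - a)) ≡ count _≟_ d (map (_- a) B)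
    column-a = begin
      ∑[ b ∈ B ] (off b a * δ (b - a))
        ≡⟨ ∑-cong-∈ B (λ {b} b∈B → trans (cong (_* δ (b - a)) (𝟙-yes (¬? (b ≟ a)) (a≢ b∈B ∘ sym)))
                                          (+-identityʳ _)) ⟩
      ∑[ b ∈ B ] δ (b - a)
        ≡⟨ count-map d (_- a) B ⟨
      count _≟_ d (map (_- a) B)
        ∎

  𝟙-∈-∷ : ∀ x a xs → 𝟙 (x ∈? (a ∷ xs)) ≤ 𝟙 (x ≟ a) + 𝟙 (x ∈? xs)
  𝟙-∈-∷ x a xs with x ≟ a
  ... | yes _ = s≤s z≤n
  ... | no x≢a = ≤-reflexive (𝟙-cong (Any.tail x≢a) there _ (x ∈? xs))

∷-unique : ∀ {x : A} {xs} → x ∉ xs → Unique xs → Unique (x ∷ xs)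
∷-unique {xs = xs} x∉ uniq = AllP.¬Any⇒All¬ xs x∉ ∷ uniq

unique-++⁻ˡ : ∀ (xs : List A) {ys} → Unique (xs ++ ys) → Unique xs
unique-++⁻ˡ []       _            = []
unique-++⁻ˡ (x ∷ xs) (x∉ ∷ uniq) = AllP.++⁻ˡ xs x∉ ∷ unique-++⁻ˡ xs uniq

sort-≡⇒↭ : ∀ {xs ys} → sort xs ≡ sort ys → xs ↭ ys
sort-≡⇒↭ {xs} {ys} eq = ↭-trans (↭-sym (sort-↭ xs)) (subst (_↭ ys) (sym eq) (sort-↭ ys))

-- ℤ/n and direct products as abelian groups

private
  [m%n+o]%n≡[m+o]%n : ∀ m o n → (m % suc n + o) % suc n ≡ (m + o) % suc n
  [m%n+o]%n≡[m+o]%n m o n = begin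
    (m % suc n + o) % suc n                 ≡⟨ %-distribˡ-+ (m % suc n) o (suc n) ⟩
    (m % suc n % suc n + o % suc n) % suc n ≡⟨ cong (λ k → (k + o % suc n) % suc n) (m%n%n≡m%n m (suc n)) ⟩
    (m % suc n + o % suc n) % suc n         ≡⟨ sym (%-distribˡ-+ m o (suc n)) ⟩
    (m + o) % suc n                         ∎
    where open ≡-Reasoning

module _ {n : ℕ} where

  toℕ-⊕ : (a b : Fin (suc n)) → toℕ (a ⊕ b) ≡ (toℕ a + toℕ b) % suc n
  toℕ-⊕ a b = toℕ-fromℕ< _

  toℕ-⊝ : (a : Fin (suc n)) → toℕ (⊝ a) ≡ (suc n ∸ toℕ a) % suc n
  toℕ-⊝ a = toℕ-fromℕ< _

  ⊕-comm : (a b : Fin (suc n)) → a ⊕ b ≡ b ⊕ a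
  ⊕-comm a b = cong (λ k → k mod suc n) (+-comm (toℕ a) (toℕ b))

  ⊕-assoc : (a b c : Fin (suc n)) → (a ⊕ b) ⊕ c ≡ a ⊕ (b ⊕ c)
  ⊕-assoc a b c = toℕ-injective (begin
    toℕ ((a ⊕ b) ⊕ c)                      ≡⟨ toℕ-⊕ (a ⊕ b) c ⟩
    (toℕ (a ⊕ b) + toℕ c) % suc n          ≡⟨ cong (λ k → (k + toℕ c) % suc n) (toℕ-⊕ a b) ⟩
    ((toℕ a + toℕ b) % suc n + toℕ c) % suc n ≡⟨ [m%n+o]%n≡[m+o]%n (toℕ a + toℕ b) (toℕ c) n ⟩
    (toℕ a + toℕ b + toℕ c) % suc n        ≡⟨ cong (_% suc n) (+-assoc (toℕ a) (toℕ b) (toℕ c)) ⟩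
    (toℕ a + (toℕ b + toℕ c)) % suc n      ≡⟨ cong (_% suc n) (+-comm (toℕ a) _) ⟩
    (toℕ b + toℕ c + toℕ a) % suc n        ≡⟨ sym ([m%n+o]%n≡[m+o]%n (toℕ b + toℕ c) (toℕ a) n) ⟩
    ((toℕ b + toℕ c) % suc n + toℕ a) % suc n ≡⟨ cong (λ k → (k + toℕ a) % suc n) (sym (toℕ-⊕ b c)) ⟩
    (toℕ (b ⊕ c) + toℕ a) % suc n          ≡⟨ cong (_% suc n) (+-comm _ (toℕ a)) ⟩
    (toℕ a + toℕ (b ⊕ c)) % suc n          ≡⟨ sym (toℕ-⊕ a (b ⊕ c)) ⟩
    toℕ (a ⊕ (b ⊕ c))                      ∎)
    where open ≡-Reasoning

  ⊕-identityˡ : (a : Fin (suc n)) → Fin.zero ⊕ a ≡ a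
  ⊕-identityˡ a = toℕ-injective (trans (toℕ-⊕ Fin.zero a) (m<n⇒m%n≡m (toℕ<n a)))

  ⊝-inverseˡ : (a : Fin (suc n)) → (⊝ a) ⊕ a ≡ Fin.zero
  ⊝-inverseˡ a = toℕ-injective (begin
    toℕ ((⊝ a) ⊕ a)                            ≡⟨ toℕ-⊕ (⊝ a) a ⟩
    (toℕ (⊝ a) + toℕ a) % suc n                ≡⟨ cong (λ k → (k + toℕ a) % suc n) (toℕ-⊝ a) ⟩
    ((suc n ∸ toℕ a) % suc n + toℕ a) % suc n  ≡⟨ [m%n+o]%n≡[m+o]%n (suc n ∸ toℕ a) (toℕ a) n ⟩
    (suc n ∸ toℕ a + toℕ a) % suc n            ≡⟨ cong (_% suc n) (m∸n+n≡m (toℕ≤n a)) ⟩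
    suc n % suc n                              ≡⟨ n%n≡0 (suc n) ⟩
    0                                          ∎)
    where open ≡-Reasoning

  ⊕-⊝-isAbelianGroup : IsAbelianGroup _≡_ (_⊕_ {suc n}) Fin.zero ⊝_
  ⊕-⊝-isAbelianGroup = record
    { isGroup = record
      { isMonoid = record
        { isSemigroup = record
          { isMagma = record { isEquivalence = isEquivalence ; ∙-cong = cong₂ _⊕_ }
          ; assoc = ⊕-assoc }
        ; identity = ⊕-identityˡ , λ a → trans (⊕-comm a Fin.zero) (⊕-identityˡ a) }
      ; inverse = ⊝-inverseˡ , λ a → trans (⊕-comm a (⊝ a)) (⊝-inverseˡ a)
      ; ⁻¹-cong = cong ⊝_ }
    ; comm = ⊕-comm }

module _ {A B : Set}
  {_∙₁_ : Op₂ A} {ε₁ : A} {_⁻¹₁ : Op₁ A} {_∙₂_ : Op₂ B} {ε₂ : B} {_⁻¹₂ : Op₁ B} where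

  ×-isAbelianGroup : IsAbelianGroup _≡_ _∙₁_ ε₁ _⁻¹₁ → IsAbelianGroup _≡_ _∙₂_ ε₂ _⁻¹₂ →
                     IsAbelianGroup _≡_ (λ x y → (proj₁ x ∙₁ proj₁ y , proj₂ x ∙₂ proj₂ y))
                                        (ε₁ , ε₂) (λ x → (proj₁ x ⁻¹₁ , proj₂ x ⁻¹₂))
  ×-isAbelianGroup G₁ G₂ = record
    { isGroup = record
      { isMonoid = record
        { isSemigroup = record
          { isMagma = record { isEquivalence = isEquivalence ; ∙-cong = λ p q → cong₂ _ p q }
          ; assoc = λ x y z → cong₂ _,_ (G₁.assoc _ _ _) (G₂.assoc _ _ _) }
        ; identity = (λ x → cong₂ _,_ (G₁.identityˡ _) (G₂.identityˡ _))
                   , (λ x → cong₂ _,_ (G₁.identityʳ _) (G₂.identityʳ _)) }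
      ; inverse = (λ x → cong₂ _,_ (G₁.inverseˡ _) (G₂.inverseˡ _))
                , (λ x → cong₂ _,_ (G₁.inverseʳ _) (G₂.inverseʳ _))
      ; ⁻¹-cong = cong (λ x → (proj₁ x ⁻¹₁ , proj₂ x ⁻¹₂)) }
    ; comm = λ x y → cong₂ _,_ (G₁.comm _ _) (G₂.comm _ _) }
    where
    module G₁ = IsAbelianGroup G₁
    module G₂ = IsAbelianGroup G₂

-- Developments in a finite abelian group

module Development
  {X : Set} {_∙_ : Op₂ X} {ε : X} {_⁻¹ : Op₁ X}
  (isAbelianGroup : IsAbelianGroup _≡_ _∙_ ε _⁻¹)
  (_≟_ : DecidableEquality X) {elements : List X} (elements-enum : Enumerates elements) where

  abelianGroup : AbelianGroup 0ℓ 0ℓ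
  abelianGroup = record { isAbelianGroup = isAbelianGroup }

  open IsAbelianGroup isAbelianGroup public using (_-_)
  open IsAbelianGroup isAbelianGroup using (identityˡ; identityʳ; inverseʳ)
  open Algebra.Properties.AbelianGroup abelianGroup public
  open Algebra.Properties.CommutativeSemigroup (AbelianGroup.commutativeSemigroup abelianGroup)
    using (x∙yz≈y∙xz)
  open Occurrences _≟_ public
  open DecMembership _≟_ public using (_∈?_)
  open ≡-Reasoning

  x-[x-y]≡y : ∀ x y → x - (x - y) ≡ y
  x-[x-y]≡y x y = begin
    x - (x - y)     ≡⟨ cong (x ∙_) (⁻¹-anti-homo‿- x y) ⟩
    x ∙ (y - x)     ≡⟨ x∙yz≈y∙xz x y (x ⁻¹) ⟩
    y ∙ (x - x)     ≡⟨ cong (y ∙_) (inverseʳ x) ⟩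
    y ∙ ε           ≡⟨ identityʳ y ⟩
    y               ∎

  y-[x-b]≡b-[x-y] : ∀ x y b → y - (x - b) ≡ b - (x - y)
  y-[x-b]≡b-[x-y] x y b = begin
    y - (x - b)     ≡⟨ cong (y ∙_) (⁻¹-anti-homo‿- x b) ⟩
    y ∙ (b - x)     ≡⟨ x∙yz≈y∙xz y b (x ⁻¹) ⟩
    b ∙ (y - x)     ≡⟨ cong (b ∙_) (⁻¹-anti-homo‿- x y) ⟨
    b - (x - y)     ∎

  translate : X → List X → List X
  translate g = map (_∙ g)

  ∈-translate⁻ : ∀ {x g B} → x ∈ translate g B → x - g ∈ B
  ∈-translate⁻ {g = g} {B} x∈ with ∈-map⁻ (_∙ g) x∈
  ... | b , b∈ , refl = subst (_∈ B) (sym (//-rightDividesʳ g b)) b∈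

  ∈-translate⁺ : ∀ {x g B} → x - g ∈ B → x ∈ translate g B
  ∈-translate⁺ {x} {g} {B} x-g∈ = subst (_∈ translate g B) (//-rightDividesˡ g x) (∈-map⁺ (_∙ g) x-g∈)

  translate-unique : ∀ g {B} → Unique B → Unique (translate g B)
  translate-unique g = Unique.map⁺ (∙-cancelʳ g _ _)

  translate-length : ∀ g B → length (translate g B) ≡ length B
  translate-length g = length-map (_∙ g)

  𝟙-∈-translate : ∀ x g {B} → Unique B → 𝟙 (x ∈? translate g B) ≡ count _≟_ (x - g) B
  𝟙-∈-translate x g {B} B-uniq =
    trans (𝟙-cong ∈-translate⁻ ∈-translate⁺ (x ∈? translate g B) ((x - g) ∈? B))
          (sym (count-unique (x - g) B-uniq))

  differences : List (List X) → List X
  differences = concatMap (diffsOf _≟_ _-_)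

  blocksAndNegatives : List (List X) → List X
  blocksAndNegatives = concatMap (λ B → B ++ map _⁻¹ B)

  x-g≡b⇒x-b≡g : ∀ {x g b} → x - g ≡ b → x - b ≡ g
  x-g≡b⇒x-b≡g {x} {g} refl = x-[x-y]≡y x g

  y-[x-b]≡c⇒x-y≡b-c : ∀ {x y b c} → y - (x - b) ≡ c → x - y ≡ b - c
  y-[x-b]≡c⇒x-y≡b-c {x} {y} {b} refl = begin
    x - y                 ≡⟨ x-[x-y]≡y b (x - y) ⟨
    b - (b - (x - y))     ≡⟨ cong (λ z → b - z) (y-[x-b]≡b-[x-y] x y b) ⟨
    b - (y - (x - b))     ∎

  x-y≡b-c⇒y-[x-b]≡c : ∀ {x y b c} → x - y ≡ b - c → y - (x - b) ≡ c
  x-y≡b-c⇒y-[x-b]≡c {x} {y} {b} {c} x-y≡b-c = begin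
    y - (x - b)           ≡⟨ y-[x-b]≡b-[x-y] x y b ⟩
    b - (x - y)           ≡⟨ cong (λ z → b - z) x-y≡b-c ⟩
    b - (b - c)           ≡⟨ x-[x-y]≡y b c ⟩
    c                     ∎

  𝟙-y-[x-b]≡c : ∀ {x y} → x ≢ y → ∀ b c →
                𝟙 ((y - (x - b)) ≟ c) ≡ 𝟙 (¬? (b ≟ c)) * 𝟙 ((x - y) ≟ (b - c))
  𝟙-y-[x-b]≡c {x} {y} x≢y b c with b ≟ c
  ... | yes refl = 𝟙-no ((y - (x - b)) ≟ b)
                        (λ eq → x≢y (x∙y⁻¹≈ε⇒x≈y x y (trans (y-[x-b]≡c⇒x-y≡b-c eq) (inverseʳ b))))
  ... | no _     = trans (𝟙-cong y-[x-b]≡c⇒x-y≡b-c x-y≡b-c⇒y-[x-b]≡c _ _) (sym (+-identityʳ _))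

  -- g ↦ (x - g , y - g) matches the translates B + g containing x and y with the pairs (b , c)
  -- of B with b - c = x - y.
  ∑-translates-inBoth : ∀ {x y} → x ≢ y → ∀ {B} → Unique B →
    ∑[ g ∈ elements ] inBoth x y (translate g B)
      ≡ count _≟_ (x - y) (diffsOf _≟_ _-_ B)
  ∑-translates-inBoth {x} {y} x≢y {B} B-uniq = begin
    ∑[ g ∈ elements ] inBoth x y (translate g B)
      ≡⟨ ∑-cong elements (λ g → cong₂ _*_ (𝟙-∈-translate x g B-uniq) (𝟙-∈-translate y g B-uniq)) ⟩
    ∑[ g ∈ elements ] (count _≟_ (x - g) B * count _≟_ (y - g) B)
      ≡⟨ ∑-cong elements (λ g → trans (cong (_* _) (count≡∑ (x - g) B)) (sym (∑-*ʳ B _ _))) ⟩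
    ∑[ g ∈ elements ] ∑[ b ∈ B ] (𝟙 ((x - g) ≟ b) * count _≟_ (y - g) B)
      ≡⟨ ∑-cong elements (λ g → ∑-cong B (λ b →
           cong (_* _) (𝟙-cong x-g≡b⇒x-b≡g x-g≡b⇒x-b≡g ((x - g) ≟ b) ((x - b) ≟ g)))) ⟩
    ∑[ g ∈ elements ] ∑[ b ∈ B ] (𝟙 ((x - b) ≟ g) * count _≟_ (y - g) B)
      ≡⟨ ∑-swap elements B _ ⟩
    ∑[ b ∈ B ] ∑[ g ∈ elements ] (𝟙 ((x - b) ≟ g) * count _≟_ (y - g) B)
      ≡⟨ ∑-cong B (λ b → ∑-enumeration-pick elements-enum (x - b) (λ g → count _≟_ (y - g) B)) ⟩
    ∑[ b ∈ B ] count _≟_ (y - (x - b)) B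
      ≡⟨ ∑-cong B (λ b → trans (count≡∑ _ B) (∑-cong B (𝟙-y-[x-b]≡c x≢y b))) ⟩
    ∑[ b ∈ B ] ∑[ c ∈ B ] (𝟙 (¬? (b ≟ c)) * 𝟙 ((x - y) ≟ (b - c)))
      ≡⟨ count-diffsOf _-_ (x - y) B ⟨
    count _≟_ (x - y) (diffsOf _≟_ _-_ B)
      ∎

  ∑-development : ∀ {x y} → x ≢ y → ∀ {ℱ} → (∀ {B} → B ∈ ℱ → Unique B) →
    ∑[ g ∈ elements ] ∑[ B ∈ ℱ ] inBoth x y (translate g B)
      ≡ count _≟_ (x - y) (differences ℱ)
  ∑-development {x} {y} x≢y {ℱ} ℱ-uniq = begin
    ∑[ g ∈ elements ] ∑[ B ∈ ℱ ] inBoth x y (translate g B)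
      ≡⟨ ∑-swap elements ℱ _ ⟩
    ∑[ B ∈ ℱ ] ∑[ g ∈ elements ] inBoth x y (translate g B)
      ≡⟨ ∑-cong-∈ ℱ (λ B∈ → ∑-translates-inBoth x≢y (ℱ-uniq B∈)) ⟩
    ∑[ B ∈ ℱ ] count _≟_ (x - y) (diffsOf _≟_ _-_ B)
      ≡⟨ count-concatMap (x - y) _ ℱ ⟨
    count _≟_ (x - y) (differences ℱ)
      ∎

  count-diffsOf-∷ε : ∀ d {B} → ε ∉ B →
    count _≟_ d (diffsOf _≟_ _-_ (ε ∷ B))
      ≡ count _≟_ d (B ++ map _⁻¹ B) + count _≟_ d (diffsOf _≟_ _-_ B)
  count-diffsOf-∷ε d {B} ε∉B = begin
    # (diffsOf _≟_ _-_ (ε ∷ B))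
      ≡⟨ count-diffsOf-∷ _-_ d ε∉B ⟩
    # (map (ε -_) B) + (# (map (_- ε) B) + # (diffsOf _≟_ _-_ B))
      ≡⟨ cong₂ (λ L L′ → # L + (# L′ + # (diffsOf _≟_ _-_ B)))
               (map-cong (λ c → identityˡ (c ⁻¹)) B) ε-neutral ⟩
    # (map _⁻¹ B) + (# B + # (diffsOf _≟_ _-_ B))
      ≡⟨ +-assoc (# (map _⁻¹ B)) _ _ ⟨
    # (map _⁻¹ B) + # B + # (diffsOf _≟_ _-_ B)
      ≡⟨ cong (_+ # (diffsOf _≟_ _-_ B))
              (trans (+-comm (# (map _⁻¹ B)) _) (sym (count-++ d B (map _⁻¹ B)))) ⟩
    # (B ++ map _⁻¹ B) + # (diffsOf _≟_ _-_ B)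
      ∎
    where
    # : List X → ℕ
    # = count _≟_ d
    ε-neutral : map (_- ε) B ≡ B
    ε-neutral = trans (map-cong (λ b → trans (cong (b ∙_) ε⁻¹≈ε) (identityʳ b)) B) (map-id B)

-- Nested designs from relative difference families

module NestedDesign
  {X : Set} {_∙_ : Op₂ X} {ε : X} {_⁻¹ : Op₁ X}
  (X-isAbelianGroup : IsAbelianGroup _≡_ _∙_ ε _⁻¹)
  (_≟_ : DecidableEquality X) {elements : List X} (elements-enum : Enumerates elements)
  {Y : Set} {_∙ʸ_ : Op₂ Y} {εʸ : Y} {_⁻¹ʸ : Op₁ Y}
  (Y-isGroup : IsGroup _≡_ _∙ʸ_ εʸ _⁻¹ʸ)
  (_≟ʸ_ : DecidableEquality Y) {elementsʸ : List Y} (elementsʸ-enum : Enumerates elementsʸ)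
  (π : X → Y) (π-homo : ∀ x y → π (x ∙ y) ≡ π x ∙ʸ π y)
  (ι : Y → X) (π∘ι : ∀ c → π (ι c) ≡ c) where

  open Development X-isAbelianGroup _≟_ elements-enum public
  open IsAbelianGroup X-isAbelianGroup using (identityˡ; inverseʳ)
  private
    Yᵍ : Group 0ℓ 0ℓ
    Yᵍ = record { isGroup = Y-isGroup }
    module Y = Algebra.Properties.Group Yᵍ
    open IsGroup Y-isGroup using () renaming (_//_ to _-ʸ_)

  π-ε : π ε ≡ εʸ
  π-ε = Y.identityˡ-unique (π ε) (π ε) (trans (sym (π-homo ε ε)) (cong π (identityˡ ε)))

  π-⁻¹ : ∀ x → π (x ⁻¹) ≡ π x ⁻¹ʸ
  π-⁻¹ x = Y.inverseʳ-unique (π x) (π (x ⁻¹))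
    (trans (sym (π-homo x (x ⁻¹))) (trans (cong π (inverseʳ x)) π-ε))

  π-- : ∀ x y → π (x - y) ≡ π x -ʸ π y
  π-- x y = trans (π-homo x (y ⁻¹)) (cong (π x ∙ʸ_) (π-⁻¹ y))

  π-x-y≡εʸ⇔ : ∀ {x y} → (π (x - y) ≡ εʸ → π x ≡ π y) × (π x ≡ π y → π (x - y) ≡ εʸ)
  π-x-y≡εʸ⇔ {x} {y} = (λ eq → Y.x∙y⁻¹≈ε⇒x≈y (π x) (π y) (trans (sym (π-- x y)) eq))
                    , (λ eq → trans (π-- x y) (Y.x≈y⇒x∙y⁻¹≈ε eq))

  kernel : List X
  kernel = filter (λ x → π x ≟ʸ εʸ) elements

  kernel-unique : Unique kernel
  kernel-unique = Unique.filter⁺ _ (proj₁ elements-enum)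

  ∈-coset⁻ : ∀ {x a} → x ∈ translate a kernel → π x ≡ π a
  ∈-coset⁻ x∈ = proj₁ π-x-y≡εʸ⇔ (proj₂ (∈-filter⁻ (λ x → π x ≟ʸ εʸ) {xs = elements} (∈-translate⁻ x∈)))

  ∈-coset⁺ : ∀ {x a} → π x ≡ π a → x ∈ translate a kernel
  ∈-coset⁺ {x} {a} eq = ∈-translate⁺ (∈-filter⁺ _ (proj₂ elements-enum (x - a)) (proj₂ π-x-y≡εʸ⇔ eq))

  count-coset : ∀ x a → count _≟_ x (translate a kernel) ≡ 𝟙 (π x ≟ʸ π a)
  count-coset x a = trans (count-unique x (translate-unique a kernel-unique))
                          (𝟙-cong ∈-coset⁻ ∈-coset⁺ _ _)

  cosetBlock : Y → List X
  cosetBlock c = translate (ι c) kernel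

  𝟙-∈-cosetBlock : ∀ x c → 𝟙 (x ∈? cosetBlock c) ≡ 𝟙 (π x ≟ʸ c)
  𝟙-∈-cosetBlock x c = 𝟙-cong (λ x∈ → trans (∈-coset⁻ x∈) (π∘ι c))
                              (λ eq → ∈-coset⁺ (trans eq (sym (π∘ι c)))) _ _

  developedBlocks : List (List X) → List (List X × X)
  developedBlocks ℱ = concatMap (λ g → map (λ B → translate g B , g) ℱ) elements

  cosetBlocks : X → List (List X × X)
  cosetBlocks t = map (λ c → cosetBlock c , t ∙ ι c) elementsʸ

  nestedDesign : List (List X) → X → List (List X × X)
  nestedDesign ℱ t = developedBlocks ℱ ++ cosetBlocks t

  augment : List X × X → List X
  augment (A , φ) = φ ∷ A

  private
    module Occʸ = Occurrences _≟ʸ_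

  π-t∙ι : ∀ t c → π (t ∙ ι c) ≡ π t ∙ʸ c
  π-t∙ι t c = trans (π-homo t (ι c)) (cong (π t ∙ʸ_) (π∘ι c))

  π-[t∙ιπy-y] : ∀ t y → π ((t ∙ ι (π y)) - y) ≡ π t
  π-[t∙ιπy-y] t y = begin
    π ((t ∙ ι (π y)) - y)          ≡⟨ π-- _ y ⟩
    π (t ∙ ι (π y)) -ʸ π y         ≡⟨ cong (_-ʸ π y) (π-t∙ι t (π y)) ⟩
    (π t ∙ʸ π y) -ʸ π y            ≡⟨ Y.//-rightDividesʳ (π y) (π t) ⟩
    π t                            ∎
    where open ≡-Reasoning

  π-[x-t∙ιπx] : ∀ t x → π (x - (t ∙ ι (π x))) ≡ π (t ⁻¹)
  π-[x-t∙ιπx] t x = begin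
    π (x - (t ∙ ι (π x)))          ≡⟨ π-- x _ ⟩
    π x -ʸ π (t ∙ ι (π x))         ≡⟨ cong (π x -ʸ_) (π-t∙ι t (π x)) ⟩
    π x -ʸ (π t ∙ʸ π x)            ≡⟨ cong (π x ∙ʸ_) (Y.⁻¹-anti-homo-∙ (π t) (π x)) ⟩
    π x ∙ʸ ((π x ⁻¹ʸ) ∙ʸ (π t ⁻¹ʸ)) ≡⟨ Y.\\-leftDividesˡ (π x) (π t ⁻¹ʸ) ⟩
    π t ⁻¹ʸ                        ≡⟨ π-⁻¹ t ⟨
    π (t ⁻¹)                       ∎
    where open ≡-Reasoning

  𝟙-same-coset : ∀ x y → 𝟙 (π y ≟ʸ π x) ≡ 𝟙 (π (x - y) ≟ʸ εʸ)
  𝟙-same-coset x y = 𝟙-cong (λ eq → proj₂ π-x-y≡εʸ⇔ (sym eq)) (λ eq → sym (proj₁ π-x-y≡εʸ⇔ eq)) _ _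

  ∑-cosetBlocks : ∀ x y → ∑[ c ∈ elementsʸ ] inBoth x y (cosetBlock c) ≡ 𝟙 (π (x - y) ≟ʸ εʸ)
  ∑-cosetBlocks x y = begin
    ∑[ c ∈ elementsʸ ] inBoth x y (cosetBlock c)
      ≡⟨ ∑-cong elementsʸ (λ c → cong₂ _*_ (𝟙-∈-cosetBlock x c) (𝟙-∈-cosetBlock y c)) ⟩
    ∑[ c ∈ elementsʸ ] (𝟙 (π x ≟ʸ c) * 𝟙 (π y ≟ʸ c))
      ≡⟨ Occʸ.∑-enumeration-pick elementsʸ-enum (π x) (λ c → 𝟙 (π y ≟ʸ c)) ⟩
    𝟙 (π y ≟ʸ π x)
      ≡⟨ 𝟙-same-coset x y ⟩
    𝟙 (π (x - y) ≟ʸ εʸ)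
      ∎
    where open ≡-Reasoning

  -- Apart from lying in a common coset, x and y share an augmented coset block only if one of
  -- them is its nesting point t ∙ ι c, which puts x - y in the coset of t or in that of t⁻¹.
  ∑-augmentedCosetBlocks : ∀ t {x y} → x ≢ y →
    ∑[ c ∈ elementsʸ ] inBoth x y ((t ∙ ι c) ∷ cosetBlock c)
      ≤ count _≟_ (x - y) (translate t kernel)
        + (count _≟_ (x - y) (translate (t ⁻¹) kernel) + 𝟙 (π (x - y) ≟ʸ εʸ))
  ∑-augmentedCosetBlocks t {x} {y} x≢y = begin
    ∑[ c ∈ elementsʸ ] inBoth x y ((t ∙ ι c) ∷ cosetBlock c)
      ≤⟨ ∑-mono elementsʸ (λ c → *-mono-≤ (split x c) (split y c)) ⟩
    ∑[ c ∈ elementsʸ ] ((Sx c + 𝟙 (π x ≟ʸ c)) * (Sy c + 𝟙 (π y ≟ʸ c)))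
      ≡⟨ Occʸ.∑-enumeration-pick₂ elementsʸ-enum Sx Sy not-both (π x) (π y) ⟩
    Sx (π y) + (Sy (π x) + 𝟙 (π y ≟ʸ π x))
      ≤⟨ +-mono-≤ (𝟙-mono x-in-coset-of-t (x ≟ _) (π (x - y) ≟ʸ π t))
           (+-mono-≤ (𝟙-mono y-in-coset-of-t (y ≟ _) (π (x - y) ≟ʸ π (t ⁻¹)))
                     (≤-reflexive (𝟙-same-coset x y))) ⟩
    𝟙 (π (x - y) ≟ʸ π t) + (𝟙 (π (x - y) ≟ʸ π (t ⁻¹)) + 𝟙 (π (x - y) ≟ʸ εʸ))
      ≡⟨ cong₂ _+_ (count-coset (x - y) t) (cong (_+ _) (count-coset (x - y) (t ⁻¹))) ⟨
    count _≟_ (x - y) (translate t kernel)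
      + (count _≟_ (x - y) (translate (t ⁻¹) kernel) + 𝟙 (π (x - y) ≟ʸ εʸ))
      ∎
    where
    open ≤-Reasoning
    Sx Sy : Y → ℕ
    Sx c = 𝟙 (x ≟ (t ∙ ι c))
    Sy c = 𝟙 (y ≟ (t ∙ ι c))
    split : ∀ z c → 𝟙 (z ∈? ((t ∙ ι c) ∷ cosetBlock c)) ≤ 𝟙 (z ≟ (t ∙ ι c)) + 𝟙 (π z ≟ʸ c)
    split z c = ≤-trans (𝟙-∈-∷ z _ _) (≤-reflexive (cong (_ +_) (𝟙-∈-cosetBlock z c)))
    not-both : ∀ c → Sx c * Sy c ≡ 0
    not-both c with x ≟ (t ∙ ι c) | y ≟ (t ∙ ι c)
    ... | yes refl | yes refl = ⊥-elim (x≢y refl)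
    ... | yes _    | no _     = refl
    ... | no _     | _        = refl
    x-in-coset-of-t : x ≡ t ∙ ι (π y) → π (x - y) ≡ π t
    x-in-coset-of-t refl = π-[t∙ιπy-y] t y
    y-in-coset-of-t : y ≡ t ∙ ι (π x) → π (x - y) ≡ π (t ⁻¹)
    y-in-coset-of-t refl = π-[x-t∙ιπx] t x

  ∑-developedBlocks : ∀ {ℱ} → (∀ {B} → B ∈ ℱ → Unique B) → ∀ {x y} → x ≢ y →
    ∑[ Aφ ∈ developedBlocks ℱ ] inBoth x y (proj₁ Aφ) ≡ count _≟_ (x - y) (differences ℱ)
  ∑-developedBlocks {ℱ} ℱ-unique {x} {y} x≢y = begin
    ∑[ Aφ ∈ developedBlocks ℱ ] inBoth x y (proj₁ Aφ)
      ≡⟨ ∑-concatMap _ elements _ ⟩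
    ∑[ g ∈ elements ] ∑[ Aφ ∈ map (λ B → translate g B , g) ℱ ] inBoth x y (proj₁ Aφ)
      ≡⟨ ∑-cong elements (λ g → ∑-map _ ℱ _) ⟩
    ∑[ g ∈ elements ] ∑[ B ∈ ℱ ] inBoth x y (translate g B)
      ≡⟨ ∑-development x≢y ℱ-unique ⟩
    count _≟_ (x - y) (differences ℱ)
      ∎
    where open ≡-Reasoning

  ∑-augmentedDevelopedBlocks : ∀ {ℱ} → (∀ {B} → B ∈ ℱ → Unique B) → (∀ {B} → B ∈ ℱ → ε ∉ B) →
    ∀ {x y} → x ≢ y →
    ∑[ Aφ ∈ developedBlocks ℱ ] inBoth x y (augment Aφ)
      ≡ count _≟_ (x - y) (blocksAndNegatives ℱ) + count _≟_ (x - y) (differences ℱ)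
  ∑-augmentedDevelopedBlocks {ℱ} ℱ-unique ε∉ℱ {x} {y} x≢y = begin
    ∑[ Aφ ∈ developedBlocks ℱ ] inBoth x y (augment Aφ)
      ≡⟨ ∑-concatMap _ elements _ ⟩
    ∑[ g ∈ elements ] ∑[ Aφ ∈ map (λ B → translate g B , g) ℱ ] inBoth x y (augment Aφ)
      ≡⟨ ∑-cong elements (λ g → trans (∑-map _ ℱ _) (trans (∑-cong ℱ (λ B → augmented-translate g B))
                                                           (sym (∑-map (ε ∷_) ℱ _)))) ⟩
    ∑[ g ∈ elements ] ∑[ B ∈ map (ε ∷_) ℱ ] inBoth x y (translate g B)
      ≡⟨ ∑-development x≢y εℱ-unique ⟩
    count _≟_ d (differences (map (ε ∷_) ℱ))
      ≡⟨ trans (count-concatMap d _ (map (ε ∷_) ℱ)) (∑-map (ε ∷_) ℱ _) ⟩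
    ∑[ B ∈ ℱ ] count _≟_ d (diffsOf _≟_ _-_ (ε ∷ B))
      ≡⟨ ∑-cong-∈ ℱ (λ B∈ → count-diffsOf-∷ε d (ε∉ℱ B∈)) ⟩
    ∑[ B ∈ ℱ ] (count _≟_ d (B ++ map _⁻¹ B) + count _≟_ d (diffsOf _≟_ _-_ B))
      ≡⟨ ∑-+ ℱ _ _ ⟩
    ∑[ B ∈ ℱ ] count _≟_ d (B ++ map _⁻¹ B) + ∑[ B ∈ ℱ ] count _≟_ d (diffsOf _≟_ _-_ B)
      ≡⟨ sym (cong₂ _+_ (count-concatMap d _ ℱ) (count-concatMap d _ ℱ)) ⟩
    count _≟_ d (blocksAndNegatives ℱ) + count _≟_ d (differences ℱ)
      ∎
    where
    open ≡-Reasoning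
    d = x - y
    augmented-translate : ∀ g B → inBoth x y (g ∷ translate g B) ≡ inBoth x y (translate g (ε ∷ B))
    augmented-translate g B = cong (λ z → inBoth x y (z ∷ translate g B)) (sym (identityˡ g))
    εℱ-unique : ∀ {B} → B ∈ map (ε ∷_) ℱ → Unique B
    εℱ-unique B∈ with ∈-map⁻ (ε ∷_) B∈
    ... | B , B∈ℱ , refl = ∷-unique (ε∉ℱ B∈ℱ) (ℱ-unique B∈ℱ)

  pairCount-map : ∀ (f : List X × X → List X) 𝒩 x y →
                  pairCount _≟_ (map f 𝒩) x y ≡ ∑[ Aφ ∈ 𝒩 ] inBoth x y (f Aφ)
  pairCount-map f 𝒩 x y = trans (pairCount≡∑ (map f 𝒩) x y) (∑-map f 𝒩 _)

  translate-ksubset : ∀ {k} g {B} → IsKSubset _≟_ k B → IsKSubset _≟_ k (translate g B)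
  translate-ksubset g {B} (B-length , B-unique) =
    trans (translate-length g B) B-length , translate-unique g B-unique

  module _ {k : ℕ} {ℱ : List (List X)} {t : X}
    (ℱ-ksubsets : ∀ {B} → B ∈ ℱ → IsKSubset _≟_ k B)
    (ℱ-differences : ∀ g → count _≟_ g (differences ℱ) ≡ 𝟙 (¬? (π g ≟ʸ εʸ)))
    (ε∉ℱ : ∀ {B} → B ∈ ℱ → ε ∉ B)
    (t∉kernel : π t ≢ εʸ)
    (separated : Unique (blocksAndNegatives ℱ ++ translate t kernel ++ translate (t ⁻¹) kernel))
    (kernel-length : length kernel ≡ k) where

    private
      ℱ-unique : ∀ {B} → B ∈ ℱ → Unique B
      ℱ-unique B∈ = proj₂ (ℱ-ksubsets B∈)

      BlockSizes : List X × X → Set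
      BlockSizes Aφ = IsKSubset _≟_ k (proj₁ Aφ) × IsKSubset _≟_ (suc k) (augment Aφ)

      developed-sizes : ∀ g {B} → B ∈ ℱ → BlockSizes (translate g B , g)
      developed-sizes g {B} B∈ =
        translate-ksubset g (ℱ-ksubsets B∈) ,
        subst (λ z → IsKSubset _≟_ (suc k) (z ∷ translate g B)) (identityˡ g)
              (translate-ksubset g (cong suc (proj₁ (ℱ-ksubsets B∈)) , ∷-unique (ε∉ℱ B∈) (ℱ-unique B∈)))

      coset-sizes : ∀ c → BlockSizes (cosetBlock c , t ∙ ι c)
      coset-sizes c =
        translate-ksubset (ι c) (kernel-length , kernel-unique) ,
        (cong suc (trans (translate-length (ι c) kernel) kernel-length) ,
         ∷-unique t∙ιc∉ (translate-unique (ι c) kernel-unique))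
        where
        t∙ιc∉ : t ∙ ι c ∉ cosetBlock c
        t∙ιc∉ t∙ιc∈ = t∉kernel (Y.identityˡ-unique (π t) c
                        (trans (sym (π-t∙ι t c)) (trans (∈-coset⁻ t∙ιc∈) (π∘ι c))))

      all-sizes : All BlockSizes (nestedDesign ℱ t)
      all-sizes = AllP.++⁺
        (AllP.concat⁺ (AllP.map⁺ (All.tabulate {xs = elements}
          (λ {g} _ → AllP.map⁺ (All.tabulate (developed-sizes g))))))
        (AllP.map⁺ (All.tabulate {xs = elementsʸ} (λ {c} _ → coset-sizes c)))

      blocks-ksubsets : ∀ A → A ∈ map proj₁ (nestedDesign ℱ t) → IsKSubset _≟_ k A
      blocks-ksubsets A = All.lookup (AllP.map⁺ {P = IsKSubset _≟_ k} (All.map proj₁ all-sizes))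

      augmented-ksubsets : ∀ A → A ∈ map augment (nestedDesign ℱ t) → IsKSubset _≟_ (suc k) A
      augmented-ksubsets A = All.lookup (AllP.map⁺ {P = IsKSubset _≟_ (suc k)} (All.map proj₂ all-sizes))

      pairCount≡1 : ∀ x y → x ≢ y → pairCount _≟_ (map proj₁ (nestedDesign ℱ t)) x y ≡ 1
      pairCount≡1 x y x≢y = begin
        pairCount _≟_ (map proj₁ (nestedDesign ℱ t)) x y
          ≡⟨ pairCount-map proj₁ (nestedDesign ℱ t) x y ⟩
        ∑[ Aφ ∈ nestedDesign ℱ t ] inBoth x y (proj₁ Aφ)
          ≡⟨ ∑-++ (developedBlocks ℱ) (cosetBlocks t) _ ⟩
        ∑[ Aφ ∈ developedBlocks ℱ ] inBoth x y (proj₁ Aφ)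
          + ∑[ Aφ ∈ cosetBlocks t ] inBoth x y (proj₁ Aφ)
          ≡⟨ cong₂ _+_ (trans (∑-developedBlocks ℱ-unique x≢y) (ℱ-differences (x - y)))
                       (trans (∑-map _ elementsʸ _) (∑-cosetBlocks x y)) ⟩
        𝟙 (¬? (π (x - y) ≟ʸ εʸ)) + 𝟙 (π (x - y) ≟ʸ εʸ)
          ≡⟨ 𝟙-¬ (π (x - y) ≟ʸ εʸ) ⟩
        1 ∎
        where open ≡-Reasoning

      pairCount≤2 : ∀ x y → x ≢ y → pairCount _≟_ (map augment (nestedDesign ℱ t)) x y ≤ 2
      pairCount≤2 x y x≢y = begin
        pairCount _≟_ (map augment (nestedDesign ℱ t)) x y
          ≡⟨ pairCount-map augment (nestedDesign ℱ t) x y ⟩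
        ∑[ Aφ ∈ nestedDesign ℱ t ] inBoth x y (augment Aφ)
          ≡⟨ ∑-++ (developedBlocks ℱ) (cosetBlocks t) _ ⟩
        ∑[ Aφ ∈ developedBlocks ℱ ] inBoth x y (augment Aφ)
          + ∑[ Aφ ∈ cosetBlocks t ] inBoth x y (augment Aφ)
          ≡⟨ cong₂ _+_ (trans (∑-augmentedDevelopedBlocks ℱ-unique ε∉ℱ x≢y)
                              (cong (# ±ℱ +_) (ℱ-differences d)))
                       (∑-map _ elementsʸ _) ⟩
        # ±ℱ + outside + ∑[ c ∈ elementsʸ ] inBoth x y ((t ∙ ι c) ∷ cosetBlock c)
          ≤⟨ +-monoʳ-≤ (# ±ℱ + outside) (∑-augmentedCosetBlocks t x≢y) ⟩
        # ±ℱ + outside + (# Hₜ + (# H₋ₜ + inside))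
          ≡⟨ regroup (# ±ℱ) outside (# Hₜ) (# H₋ₜ) inside ⟩
        (outside + inside) + (# ±ℱ + (# Hₜ + # H₋ₜ))
          ≡⟨ cong₂ _+_ (𝟙-¬ (π d ≟ʸ εʸ))
                       (sym (trans (count-++ d ±ℱ _) (cong (# ±ℱ +_) (count-++ d Hₜ H₋ₜ)))) ⟩
        1 + # (±ℱ ++ Hₜ ++ H₋ₜ)
          ≤⟨ +-monoʳ-≤ 1 (unique⇒count≤1 d separated) ⟩
        2 ∎
        where
        open ≤-Reasoning
        d = x - y
        # : List X → ℕ
        # = count _≟_ d
        outside inside : ℕ
        outside = 𝟙 (¬? (π d ≟ʸ εʸ))
        inside = 𝟙 (π d ≟ʸ εʸ)
        ±ℱ = blocksAndNegatives ℱ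
        Hₜ = translate t kernel
        H₋ₜ = translate (t ⁻¹) kernel
        regroup : ∀ a b c e f → a + b + (c + (e + f)) ≡ (b + f) + (a + (c + e))
        regroup = solve-∀

    nestedDesign-isNestedBIBD : IsNestedBIBD _≟_ k 1 (nestedDesign ℱ t)
    nestedDesign-isNestedBIBD = (blocks-ksubsets , pairCount≡1) , (augmented-ksubsets , pairCount≤2)

-- Transport along bijections

module _ {X Y : Set} (_≟X_ : DecidableEquality X) (_≟Y_ : DecidableEquality Y) where
  private
    module OccX = Occurrences _≟X_
    module OccY = Occurrences _≟Y_

  count-map-injective : (f : X → Y) → (∀ {a b} → f a ≡ f b → a ≡ b) →
                        ∀ x xs → count _≟Y_ (f x) (map f xs) ≡ count _≟X_ x xs
  count-map-injective f f-injective x xs = begin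
    count _≟Y_ (f x) (map f xs)      ≡⟨ OccY.count-map (f x) f xs ⟩
    ∑[ a ∈ xs ] 𝟙 (f x ≟Y f a)       ≡⟨ ∑-cong xs (λ a → 𝟙-cong f-injective (cong f) _ _) ⟩
    ∑[ a ∈ xs ] 𝟙 (x ≟X a)           ≡⟨ OccX.count≡∑ x xs ⟨
    count _≟X_ x xs                  ∎
    where open ≡-Reasoning

  module _ (e : X ↔ Y) where
    open Inverse e using (to; from; strictlyInverseˡ; strictlyInverseʳ)
    open DecMembership _≟X_ using () renaming (_∈?_ to _∈X?_)
    open DecMembership _≟Y_ using () renaming (_∈?_ to _∈Y?_)
    private
      to-injective : ∀ {a b} → to a ≡ to b → a ≡ b
      to-injective = Injection.injective (↔⇒↣ e)

      from-injective : ∀ {a b} → from a ≡ from b → a ≡ b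
      from-injective = Injection.injective (↔⇒↣ (↔-sym e))

    𝟙-∈-map-to : ∀ y A → 𝟙 (y ∈Y? map to A) ≡ 𝟙 (from y ∈X? A)
    𝟙-∈-map-to y A = 𝟙-cong ∈-map-to⁻ ∈-map-to⁺ (y ∈Y? map to A) (from y ∈X? A)
      where
      ∈-map-to⁻ : y ∈ map to A → from y ∈ A
      ∈-map-to⁻ y∈ with ∈-map⁻ to y∈
      ... | a , a∈ , refl = subst (_∈ A) (sym (strictlyInverseʳ a)) a∈
      ∈-map-to⁺ : from y ∈ A → y ∈ map to A
      ∈-map-to⁺ fy∈ = subst (_∈ map to A) (strictlyInverseˡ y) (∈-map⁺ to fy∈)

    pairCount-map-to : ∀ 𝒜 y₁ y₂ →
                       pairCount _≟Y_ (map (map to) 𝒜) y₁ y₂ ≡ pairCount _≟X_ 𝒜 (from y₁) (from y₂)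
    pairCount-map-to 𝒜 y₁ y₂ = begin
      pairCount _≟Y_ (map (map to) 𝒜) y₁ y₂
        ≡⟨ OccY.pairCount≡∑ (map (map to) 𝒜) y₁ y₂ ⟩
      ∑[ A ∈ map (map to) 𝒜 ] OccY.inBoth y₁ y₂ A
        ≡⟨ ∑-map (map to) 𝒜 _ ⟩
      ∑[ A ∈ 𝒜 ] OccY.inBoth y₁ y₂ (map to A)
        ≡⟨ ∑-cong 𝒜 (λ A → cong₂ _*_ (𝟙-∈-map-to y₁ A) (𝟙-∈-map-to y₂ A)) ⟩
      ∑[ A ∈ 𝒜 ] OccX.inBoth (from y₁) (from y₂) A
        ≡⟨ OccX.pairCount≡∑ 𝒜 (from y₁) (from y₂) ⟨
      pairCount _≟X_ 𝒜 (from y₁) (from y₂)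
        ∎
      where open ≡-Reasoning

    ksubset-map-to : ∀ {k A} → IsKSubset _≟X_ k A → IsKSubset _≟Y_ k (map to A)
    ksubset-map-to {A = A} (A-length , A-unique) =
      trans (length-map to A) A-length , Unique.map⁺ to-injective A-unique

    private
      ksubsets-map-to : ∀ {k 𝒜} → (∀ A → A ∈ 𝒜 → IsKSubset _≟X_ k A) →
                        ∀ B → B ∈ map (map to) 𝒜 → IsKSubset _≟Y_ k B
      ksubsets-map-to ksubsets B B∈ with ∈-map⁻ (map to) B∈
      ... | A , A∈ , refl = ksubset-map-to (ksubsets A A∈)

      pairCount-bound-map-to : ∀ {𝒜} {R : ℕ → Set} → (∀ x₁ x₂ → x₁ ≢ x₂ → R (pairCount _≟X_ 𝒜 x₁ x₂)) →
                               ∀ y₁ y₂ → y₁ ≢ y₂ → R (pairCount _≟Y_ (map (map to) 𝒜) y₁ y₂)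
      pairCount-bound-map-to {𝒜} {R} bound y₁ y₂ y₁≢y₂ =
        subst R (sym (pairCount-map-to 𝒜 y₁ y₂)) (bound _ _ (λ eq → y₁≢y₂ (from-injective eq)))

    IsNestedBIBD-map-to : ∀ {k lam} 𝒩 → IsNestedBIBD _≟X_ k lam 𝒩 →
                          IsNestedBIBD _≟Y_ k lam (map (Product.map (map to) to) 𝒩)
    IsNestedBIBD-map-to {k} {lam} 𝒩 ((ksubsets , pairs) , (ksubsets⁺ , pairs⁺)) =
      subst (IsBIBD _≟Y_ k lam) (trans (sym (map-∘ 𝒩)) (map-∘ 𝒩))
            (ksubsets-map-to ksubsets , pairCount-bound-map-to {map proj₁ 𝒩} {R = _≡ lam} pairs) ,
      subst (IsPartialBIBD _≟Y_ (suc k) (suc lam)) (trans (sym (map-∘ 𝒩)) (map-∘ 𝒩))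
            (ksubsets-map-to ksubsets⁺ ,
             pairCount-bound-map-to {map (λ Aφ → proj₂ Aφ ∷ proj₁ Aφ) 𝒩} {R = _≤ suc lam} pairs⁺)

-- The group F₄ × F_q with q = p²

module _ {m : ℕ} where

  Y : Set
  Y = Fin (suc m) × Fin (suc m)

  0ʸ : Y
  0ʸ = (Fin.zero , Fin.zero)

  _≟ʸ_ : DecidableEquality Y
  _≟ʸ_ = ×-≡-dec _≟_ _≟_

  Y-isAbelianGroup : IsAbelianGroup _≡_ _ 0ʸ _
  Y-isAbelianGroup = ×-isAbelianGroup (⊕-⊝-isAbelianGroup {m}) (⊕-⊝-isAbelianGroup {m})

  G-isAbelianGroup : IsAbelianGroup _≡_ (gadd {suc m}) (Fin.zero , Fin.zero , 0ʸ) gneg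
  G-isAbelianGroup =
    ×-isAbelianGroup ⊕-⊝-isAbelianGroup (×-isAbelianGroup ⊕-⊝-isAbelianGroup Y-isAbelianGroup)

  elementsʸ : List Y
  elementsʸ = cartesianProduct (allFin (suc m)) (allFin (suc m))

  elements : List (G (suc m))
  elements = cartesianProduct (allFin 2) (cartesianProduct (allFin 2) elementsʸ)

  elementsʸ-enum : Enumerates elementsʸ
  elementsʸ-enum = cartesianProduct-enumerates (allFin-enumerates _) (allFin-enumerates _)

  elements-enum : Enumerates elements
  elements-enum = cartesianProduct-enumerates (allFin-enumerates 2)
                    (cartesianProduct-enumerates (allFin-enumerates 2) elementsʸ-enum)

  π : G (suc m) → Y
  π (_ , _ , y) = y

  ι : Y → G (suc m)
  ι y = (Fin.zero , Fin.zero , y)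

  open NestedDesign G-isAbelianGroup _≟G_ elements-enum
                    (IsAbelianGroup.isGroup Y-isAbelianGroup) _≟ʸ_ elementsʸ-enum
                    π (λ _ _ → refl) ι (λ _ → refl)

  InH⇒π≡0 : ∀ {g} → InH g → π g ≡ 0ʸ
  InH⇒π≡0 {_ , _ , b₁ , b₂} (b₁≡0 , b₂≡0) = cong₂ _,_ (toℕ-injective b₁≡0) (toℕ-injective b₂≡0)

  π≡0⇒InH : ∀ {g} → π g ≡ 0ʸ → InH g
  π≡0⇒InH refl = refl , refl

  G↔Fin : G (suc m) ↔ Fin (4 * (suc m * suc m))
  G↔Fin = ↔-trans (↔-sym Σ-assoc) (↔-trans (↔-sym *↔× ×-↔ ↔-sym *↔×) (↔-sym *↔×))

  code : G (suc m) → ℕ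
  code = toℕ ∘ Inverse.to G↔Fin

  kernelᶜ : List (G (suc m))
  kernelᶜ = filter (λ g → ¬? (π g ≟ʸ 0ʸ)) elements

  code-injective : ∀ {g h} → code g ≡ code h → g ≡ h
  code-injective eq = Injection.injective (↔⇒↣ G↔Fin) (toℕ-injective eq)

  isKSubset? : ∀ k (B : List (G (suc m))) → Dec (IsKSubset _≟G_ k B)
  isKSubset? k B = (length B ℕ.≟ k) ×-dec unique? _≟G_ B

  -- A permutation of G ∖ H is recognised by sorting the codes of its elements in ℕ:
  -- this is what keeps the check of the difference condition cheap.
  count-via-sorted-codes : ∀ {xs} → sort (map code xs) ≡ sort (map code kernelᶜ) →
                           ∀ g → count _≟G_ g xs ≡ 𝟙 (¬? (π g ≟ʸ 0ʸ))
  count-via-sorted-codes {xs} same-sorted-codes g = begin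
    count _≟G_ g xs
      ≡⟨ count-map-injective _≟G_ ℕ._≟_ code code-injective g xs ⟨
    count ℕ._≟_ (code g) (map code xs)
      ≡⟨ Occurrences.count-↭ ℕ._≟_ (code g) (sort-≡⇒↭ {map code xs} {map code kernelᶜ} same-sorted-codes) ⟩
    count ℕ._≟_ (code g) (map code kernelᶜ)
      ≡⟨ count-map-injective _≟G_ ℕ._≟_ code code-injective g kernelᶜ ⟩
    count _≟G_ g kernelᶜ
      ≡⟨ count-filter elements-enum (λ g → ¬? (π g ≟ʸ 0ʸ)) g ⟩
    𝟙 (¬? (π g ≟ʸ 0ʸ))
      ∎
    where open ≡-Reasoning

  certified-BRDF-and-nestedBIBD : (ℱ : List (List (G (suc m)))) (t : G (suc m)) →
    True (All.all? (isKSubset? 4) ℱ) →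
    sort (map code (differences ℱ)) ≡ sort (map code kernelᶜ) →
    True (All.all? (All.all? (λ b → ¬? (π b ≟ʸ 0ʸ))) ℱ) →
    True (¬? (π t ≟ʸ 0ʸ)) →
    True (unique? _≟G_ (blocksAndNegatives ℱ ++ translate t kernel ++ translate (gneg t) kernel)) →
    length kernel ≡ 4 →
    Σ (List (List (G (suc m)))) (IsBRDF (suc m) 4 1) ×
    Σ (List (List (Fin (4 * (suc m * suc m))) × Fin (4 * (suc m * suc m)))) (IsNestedBIBD _≟_ 4 1)
  certified-BRDF-and-nestedBIBD ℱ t ksubsets same-sorted-codes avoids t∉kernel separated kernel-length =
    (ℱ , ((λ _ → ℱ-ksubsets) , rdf) , (λ _ B∈ b b∈ → avoids-kernel B∈ b∈ ∘ InH⇒π≡0 {b}) ,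
         unique-++⁻ˡ _ (toWitness separated)) ,
    (_ , IsNestedBIBD-map-to _≟G_ _≟_ G↔Fin (nestedDesign ℱ t)
           (nestedDesign-isNestedBIBD ℱ-ksubsets ℱ-differences (λ B∈ ε∈B → avoids-kernel B∈ ε∈B refl)
                                      (toWitness t∉kernel) (toWitness separated) kernel-length))
    where
    ℱ-ksubsets : ∀ {B} → B ∈ ℱ → IsKSubset _≟G_ 4 B
    ℱ-ksubsets = All.lookup (toWitness ksubsets)
    avoids-kernel : ∀ {B b} → B ∈ ℱ → b ∈ B → π b ≢ 0ʸ
    avoids-kernel B∈ = All.lookup (All.lookup (toWitness avoids) B∈)
    ℱ-differences : ∀ g → count _≟G_ g (differences ℱ) ≡ 𝟙 (¬? (π g ≟ʸ 0ʸ))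
    ℱ-differences = count-via-sorted-codes {differences ℱ} same-sorted-codes
    rdf : ∀ g → (¬ InH g → count _≟G_ g (differences ℱ) ≡ 1) × (InH g → count _≟G_ g (differences ℱ) ≡ 0)
    rdf g = (λ g∉H → trans (ℱ-differences g) (𝟙-yes (¬? (π g ≟ʸ 0ʸ)) (g∉H ∘ π≡0⇒InH {g})))
          , (λ g∈H → trans (ℱ-differences g) (𝟙-no (¬? (π g ≟ʸ 0ʸ)) (λ π≢0 → π≢0 (InH⇒π≡0 {g} g∈H))))

pt : ∀ {p} .{{_ : NonZero p}} → ℕ → ℕ → ℕ → ℕ → G p
pt {p} a b c d = (a mod 2 , b mod 2 , c mod p , d mod p)

-- Base blocks and t found by computer search.

ℱ₅ : List (List (G 5))
ℱ₅ =
  (pt 0 1 3 3 ∷ pt 0 1 4 3 ∷ pt 0 1 1 0 ∷ pt 0 1 1 4 ∷ [])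
  ∷ (pt 1 0 0 4 ∷ pt 0 0 1 4 ∷ pt 1 1 3 1 ∷ pt 0 1 3 0 ∷ [])
  ∷ (pt 1 1 4 3 ∷ pt 1 0 0 3 ∷ pt 0 0 2 0 ∷ pt 0 1 2 4 ∷ [])
  ∷ (pt 1 0 3 4 ∷ pt 0 1 4 4 ∷ pt 0 0 1 1 ∷ pt 1 1 1 0 ∷ [])
  ∷ (pt 1 1 0 3 ∷ pt 1 1 3 3 ∷ pt 1 1 4 4 ∷ pt 1 1 4 1 ∷ [])
  ∷ (pt 0 1 2 1 ∷ pt 1 1 0 1 ∷ pt 0 0 1 2 ∷ pt 1 0 1 4 ∷ [])
  ∷ (pt 0 1 0 4 ∷ pt 0 0 3 4 ∷ pt 1 0 4 0 ∷ pt 1 1 4 2 ∷ [])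
  ∷ (pt 1 0 3 3 ∷ pt 0 1 1 3 ∷ pt 0 0 2 4 ∷ pt 1 1 2 1 ∷ [])
  ∷ []
t₅ : G 5
t₅ = pt 0 0 2 3

ℱ₇ : List (List (G 7))
ℱ₇ =
  (pt 1 0 6 2 ∷ pt 1 0 0 2 ∷ pt 1 0 0 1 ∷ pt 1 0 1 4 ∷ [])
  ∷ (pt 0 0 2 3 ∷ pt 1 0 3 3 ∷ pt 0 1 3 2 ∷ pt 1 1 4 5 ∷ [])
  ∷ (pt 0 1 5 2 ∷ pt 0 0 6 2 ∷ pt 1 0 6 1 ∷ pt 1 1 0 4 ∷ [])
  ∷ (pt 1 1 2 4 ∷ pt 0 0 3 4 ∷ pt 0 1 3 3 ∷ pt 1 0 4 6 ∷ [])
  ∷ (pt 0 0 6 4 ∷ pt 0 0 4 5 ∷ pt 0 0 1 0 ∷ pt 0 0 1 2 ∷ [])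
  ∷ (pt 1 0 6 0 ∷ pt 0 0 4 1 ∷ pt 1 1 1 3 ∷ pt 0 1 1 5 ∷ [])
  ∷ (pt 1 0 1 2 ∷ pt 1 1 6 3 ∷ pt 0 1 3 5 ∷ pt 0 0 3 0 ∷ [])
  ∷ (pt 1 1 3 0 ∷ pt 0 0 1 1 ∷ pt 0 1 5 3 ∷ pt 1 0 5 5 ∷ [])
  ∷ (pt 0 1 2 6 ∷ pt 0 1 2 2 ∷ pt 0 1 0 2 ∷ pt 0 1 6 5 ∷ [])
  ∷ (pt 0 0 5 1 ∷ pt 1 0 5 4 ∷ pt 0 1 3 4 ∷ pt 1 1 2 0 ∷ [])
  ∷ (pt 1 0 1 3 ∷ pt 1 1 1 6 ∷ pt 0 1 6 6 ∷ pt 0 0 5 2 ∷ [])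
  ∷ (pt 0 0 3 5 ∷ pt 1 1 3 1 ∷ pt 1 0 1 1 ∷ pt 0 1 0 4 ∷ [])
  ∷ (pt 0 1 5 0 ∷ pt 0 1 0 1 ∷ pt 0 1 4 6 ∷ pt 0 1 1 6 ∷ [])
  ∷ (pt 1 1 1 5 ∷ pt 0 1 3 6 ∷ pt 1 0 0 4 ∷ pt 0 0 4 4 ∷ [])
  ∷ (pt 1 0 3 4 ∷ pt 1 1 5 5 ∷ pt 0 1 2 3 ∷ pt 0 0 6 3 ∷ [])
  ∷ (pt 1 1 0 1 ∷ pt 0 0 2 2 ∷ pt 0 1 6 0 ∷ pt 1 0 3 0 ∷ [])
  ∷ []
t₇ : G 7
t₇ = pt 0 0 2 1

ℱ₁₁ : List (List (G 11))
ℱ₁₁ =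
  (pt 1 1 7 6 ∷ pt 1 1 8 6 ∷ pt 1 1 6 3 ∷ pt 1 1 2 0 ∷ [])
  ∷ (pt 0 1 9 1 ∷ pt 1 1 10 1 ∷ pt 0 0 8 9 ∷ pt 1 0 4 6 ∷ [])
  ∷ (pt 1 1 0 3 ∷ pt 1 0 1 3 ∷ pt 0 0 10 0 ∷ pt 0 1 6 8 ∷ [])
  ∷ (pt 1 1 1 5 ∷ pt 0 0 2 5 ∷ pt 0 1 0 2 ∷ pt 1 0 7 10 ∷ [])
  ∷ (pt 1 1 1 7 ∷ pt 1 1 1 1 ∷ pt 1 1 4 2 ∷ pt 1 1 7 4 ∷ [])
  ∷ (pt 1 0 9 2 ∷ pt 0 0 9 7 ∷ pt 1 1 1 8 ∷ pt 0 1 4 10 ∷ [])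
  ∷ (pt 0 0 0 9 ∷ pt 0 1 0 3 ∷ pt 1 1 3 4 ∷ pt 1 0 6 6 ∷ [])
  ∷ (pt 1 1 7 3 ∷ pt 0 0 7 8 ∷ pt 0 1 10 9 ∷ pt 1 0 2 0 ∷ [])
  ∷ (pt 0 1 1 3 ∷ pt 0 1 7 3 ∷ pt 0 1 6 7 ∷ pt 0 1 4 0 ∷ [])
  ∷ (pt 0 1 7 6 ∷ pt 1 1 2 6 ∷ pt 0 0 1 10 ∷ pt 1 0 10 3 ∷ [])
  ∷ (pt 1 0 9 10 ∷ pt 1 1 4 10 ∷ pt 0 1 3 3 ∷ pt 0 0 1 7 ∷ [])
  ∷ (pt 1 0 0 2 ∷ pt 0 1 6 2 ∷ pt 0 0 5 6 ∷ pt 1 1 3 10 ∷ [])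
  ∷ (pt 1 0 1 9 ∷ pt 1 0 1 6 ∷ pt 1 0 8 1 ∷ pt 1 0 4 2 ∷ [])
  ∷ (pt 1 1 7 2 ∷ pt 0 1 7 10 ∷ pt 1 0 3 5 ∷ pt 0 0 10 6 ∷ [])
  ∷ (pt 1 0 5 6 ∷ pt 1 1 5 3 ∷ pt 0 1 1 9 ∷ pt 0 0 8 10 ∷ [])
  ∷ (pt 1 0 7 1 ∷ pt 0 1 7 9 ∷ pt 0 0 3 4 ∷ pt 1 1 10 5 ∷ [])
  ∷ (pt 1 1 8 10 ∷ pt 1 1 0 10 ∷ pt 1 1 5 1 ∷ pt 1 1 4 3 ∷ [])
  ∷ (pt 0 1 9 0 ∷ pt 1 1 1 0 ∷ pt 0 0 6 2 ∷ pt 1 0 5 4 ∷ [])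
  ∷ (pt 0 1 1 4 ∷ pt 0 0 4 4 ∷ pt 1 0 9 6 ∷ pt 1 1 8 8 ∷ [])
  ∷ (pt 0 1 10 3 ∷ pt 1 0 2 3 ∷ pt 1 1 7 5 ∷ pt 0 0 6 7 ∷ [])
  ∷ (pt 0 0 7 6 ∷ pt 0 0 7 10 ∷ pt 0 0 5 2 ∷ pt 0 0 3 8 ∷ [])
  ∷ (pt 0 0 10 2 ∷ pt 1 0 10 6 ∷ pt 0 1 8 9 ∷ pt 1 1 6 4 ∷ [])
  ∷ (pt 1 0 5 0 ∷ pt 1 1 5 4 ∷ pt 0 1 3 7 ∷ pt 0 0 1 2 ∷ [])
  ∷ (pt 0 0 9 0 ∷ pt 1 1 9 4 ∷ pt 1 0 7 7 ∷ pt 0 1 5 2 ∷ [])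
  ∷ (pt 0 0 7 5 ∷ pt 0 0 3 5 ∷ pt 0 0 0 6 ∷ pt 0 0 5 7 ∷ [])
  ∷ (pt 1 0 10 10 ∷ pt 0 0 6 10 ∷ pt 1 1 3 0 ∷ pt 0 1 8 1 ∷ [])
  ∷ (pt 0 0 6 1 ∷ pt 0 1 2 1 ∷ pt 1 1 10 2 ∷ pt 1 0 4 3 ∷ [])
  ∷ (pt 0 0 5 3 ∷ pt 1 1 1 3 ∷ pt 1 0 9 4 ∷ pt 0 1 3 5 ∷ [])
  ∷ (pt 0 0 8 2 ∷ pt 0 0 8 4 ∷ pt 0 0 7 0 ∷ pt 0 0 6 3 ∷ [])
  ∷ (pt 1 1 2 2 ∷ pt 0 1 2 4 ∷ pt 1 0 1 0 ∷ pt 0 0 0 3 ∷ [])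
  ∷ (pt 0 0 10 8 ∷ pt 0 1 10 10 ∷ pt 1 1 9 6 ∷ pt 1 0 8 9 ∷ [])
  ∷ (pt 1 0 8 0 ∷ pt 0 1 8 2 ∷ pt 0 0 7 9 ∷ pt 1 1 6 1 ∷ [])
  ∷ (pt 0 0 0 4 ∷ pt 0 0 9 4 ∷ pt 0 0 2 10 ∷ pt 0 0 10 5 ∷ [])
  ∷ (pt 1 0 0 3 ∷ pt 0 0 9 3 ∷ pt 1 1 2 9 ∷ pt 0 1 10 4 ∷ [])
  ∷ (pt 1 0 10 4 ∷ pt 1 1 8 4 ∷ pt 0 1 1 10 ∷ pt 0 0 9 5 ∷ [])
  ∷ (pt 0 1 8 3 ∷ pt 1 0 6 3 ∷ pt 1 1 10 9 ∷ pt 0 0 7 4 ∷ [])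
  ∷ (pt 0 0 2 2 ∷ pt 0 0 2 3 ∷ pt 0 0 7 1 ∷ pt 0 0 1 8 ∷ [])
  ∷ (pt 0 1 4 3 ∷ pt 1 1 4 4 ∷ pt 0 0 9 2 ∷ pt 1 0 3 9 ∷ [])
  ∷ (pt 0 0 4 8 ∷ pt 0 1 4 9 ∷ pt 1 1 9 7 ∷ pt 1 0 3 3 ∷ [])
  ∷ (pt 0 1 7 5 ∷ pt 1 0 7 6 ∷ pt 1 1 1 4 ∷ pt 0 0 6 0 ∷ [])
  ∷ []
t₁₁ : G 11
t₁₁ = pt 0 0 3 6

corollary4p23 : (p : ℕ) → (p ≡ 5 ⊎ p ≡ 7 ⊎ p ≡ 11) →
    Σ (List (List (G p))) (λ ℱ → IsBRDF p 4 1 ℱ) ×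
    Σ (List (List (Fin (4 * (p * p))) × Fin (4 * (p * p))))
      (λ 𝒩 → IsNestedBIBD _≟_ 4 1 𝒩)
corollary4p23 .5  (inj₁ refl)        = certified-BRDF-and-nestedBIBD ℱ₅ t₅ tt refl tt tt tt refl
corollary4p23 .7  (inj₂ (inj₁ refl)) = certified-BRDF-and-nestedBIBD ℱ₇ t₇ tt refl tt tt tt refl
corollary4p23 .11 (inj₂ (inj₂ refl)) = certified-BRDF-and-nestedBIBD ℱ₁₁ t₁₁ tt refl tt tt tt refl
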